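{- Let $L$ be a residuated lattice, $n\geq 1$ an integer, and $F$ a filter of $L$. Then $F$ is an $n$-fold implicative filter of $L$ if and only if the quotient $L/F$ is an $n$-fold implicative residuated lattice.
   Context: A residuated lattice is an algebra $(L,\wedge,\vee,\otimes,\rightarrow,0,1)$ such that $(L,\wedge,\vee,0,1)$ is a bounded lattice, $(L,\otimes,1)$ is a commutative monoid, and $x\otimes y\leq z$ iff $x\leq y\rightarrow z$. A filter of $L$ is a nonempty subset closed under $\otimes$ and upward closed. For a filter $F$, the relation $x\equiv_F y$ iff $x\rightarrow y\in F$ and $y\rightarrow x\in F$ is a congruence, and $L/F$ is the quotient residuated lattice with operations induced from $L$ (e.g. $x/F\rightarrow y/F=(x\rightarrow y)/F$). For $x\in L$ and $k\geq1$, $x^k=x\otimes\cdots\otimes x$ ($k$ factors). A residuated lattice $M$ is $n$-fold implicative if $x^{n+1}=x^n$ for all $x\in M$. A subset $F\subseteq L$ is an $n$-fold implicative filter if $1\in F$ and for all $x,y,z\in L$: $x^n\rightarrow(y\rightarrow z)\in F$ and $x^n\rightarrow y\in F$ imply $x^n\rightarrow z\in F$. -}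

module Defs where

open import Level using (Level; _⊔_; suc)
open import Data.Nat using (ℕ; zero) renaming (suc to sucℕ)
open import Data.Product using (∃; _×_)
open import Relation.Binary.PropositionalEquality using (_≡_)

record ResiduatedLattice (a : Level) : Set (suc a) where
  infixr 6 _∨_
  infixr 7 _∧_
  infixr 8 _⊗_
  infixr 5 _⇒_
  infix 4 _≤_
  field
    Carrier : Set a
    _∧_ _∨_ _⊗_ _⇒_ : Carrier → Carrier → Carrier
    𝟎 𝟏 : Carrier
    ∧-comm : ∀ x y → x ∧ y ≡ y ∧ x
    ∨-comm : ∀ x y → x ∨ y ≡ y ∨ x
    ∧-assoc : ∀ x y z → (x ∧ y) ∧ z ≡ x ∧ (y ∧ z)
    ∨-assoc : ∀ x y z → (x ∨ y) ∨ z ≡ x ∨ (y ∨ z)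
    ∧-absorbs-∨ : ∀ x y → x ∧ (x ∨ y) ≡ x
    ∨-absorbs-∧ : ∀ x y → x ∨ (x ∧ y) ≡ x
    𝟎-least : ∀ x → 𝟎 ∧ x ≡ 𝟎
    𝟏-greatest : ∀ x → x ∧ 𝟏 ≡ x
    ⊗-comm : ∀ x y → x ⊗ y ≡ y ⊗ x
    ⊗-assoc : ∀ x y z → (x ⊗ y) ⊗ z ≡ x ⊗ (y ⊗ z)
    ⊗-identityʳ : ∀ x → x ⊗ 𝟏 ≡ x
  _≤_ : Carrier → Carrier → Set a
  x ≤ y = x ∧ y ≡ x
  field
    residuated₁ : ∀ x y z → x ⊗ y ≤ z → x ≤ y ⇒ z
    residuated₂ : ∀ x y z → x ≤ y ⇒ z → x ⊗ y ≤ z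

pow : ∀ {a} {A : Set a} → (A → A → A) → A → A → ℕ → A
pow _∙_ e x zero = e
pow _∙_ e x (sucℕ k) = x ∙ pow _∙_ e x k

IsNFoldImplicativeAlg : ∀ {a ℓ} (A : Set a) (_≈_ : A → A → Set ℓ)
  (_∙_ : A → A → A) (e : A) (n : ℕ) → Set (a ⊔ ℓ)
IsNFoldImplicativeAlg A _≈_ _∙_ e n =
  ∀ x → pow _∙_ e x (sucℕ n) ≈ pow _∙_ e x n

module _ {a : Level} (L : ResiduatedLattice a) where
  open ResiduatedLattice L

  _^_ : Carrier → ℕ → Carrier
  x ^ k = pow _⊗_ 𝟏 x k

  record IsFilter (F : Carrier → Set a) : Set a where
    field
      nonempty : ∃ λ x → F x
      ⊗-closed : ∀ {x y} → F x → F y → F (x ⊗ y)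
      up-closed : ∀ {x y} → F x → x ≤ y → F y

  record IsNFoldImplicativeFilter (n : ℕ) (F : Carrier → Set a) : Set a where
    field
      has-𝟏 : F 𝟏
      rule : ∀ x y z → F ((x ^ n) ⇒ (y ⇒ z)) → F ((x ^ n) ⇒ y) → F ((x ^ n) ⇒ z)

  _≡[_]_ : Carrier → (Carrier → Set a) → Carrier → Set a
  x ≡[ F ] y = F (x ⇒ y) × F (y ⇒ x)

  -- The quotient L/F: elements x/F represented by x ∈ L, equality x/F = y/F
  -- iff x ≡_F y, operations induced from L (here ⊗ and 1 are what matter).
  QuotientIsNFoldImplicative : (F : Carrier → Set a) → ℕ → Set a
  QuotientIsNFoldImplicative F n =
    IsNFoldImplicativeAlg Carrier (λ x y → x ≡[ F ] y) _⊗_ 𝟏 n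

module Submission where

-- (⇒) Since x^(n+1) ≤ x^n always holds, only x^n ⇒ x^(n+1) ∈ F is at
--     stake; it follows from the filter rule applied to x^n ⇒ (x ⇒ x^(n+1))
--     and x^n ⇒ x, both equal to 1 (the second because n ≥ 1).
-- (⇐) From x^n ⇒ x ⊗ x^n ∈ F one iterates to x^n ⇒ x^n ⊗ x^n ∈ F; combined
--     with the key inequality for p = x^n this yields the filter rule.

open import Defs hiding (_^_)
import Defs
open import Level using (Level)
open import Data.Nat using (ℕ; _≤_; zero; suc; s≤s)
open import Data.Product using (_,_; proj₂)
open import Function.Bundles using (_⇔_; mk⇔)
open import Relation.Binary.Structures using (IsPreorder)
open import Relation.Binary.PropositionalEquality
  using (_≡_; refl; sym; cong; subst; isEquivalence; module ≡-Reasoning)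

module ResiduatedLatticeProperties {a : Level} (L : ResiduatedLattice a) where
  open ResiduatedLattice L public renaming (_≤_ to _≼_)

  ≼-refl : ∀ x → x ≼ x
  ≼-refl x = begin
    x ∧ x             ≡⟨ cong (x ∧_) (∨-absorbs-∧ x x) ⟨
    x ∧ (x ∨ x ∧ x)   ≡⟨ ∧-absorbs-∨ x (x ∧ x) ⟩
    x                 ∎
    where open ≡-Reasoning

  ≼-reflexive : ∀ {x y} → x ≡ y → x ≼ y
  ≼-reflexive {x} refl = ≼-refl x

  ≼-trans : ∀ {x y z} → x ≼ y → y ≼ z → x ≼ z
  ≼-trans {x} {y} {z} x≼y y≼z = begin
    x ∧ z           ≡⟨ cong (_∧ z) x≼y ⟨
    (x ∧ y) ∧ z     ≡⟨ ∧-assoc x y z ⟩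
    x ∧ (y ∧ z)     ≡⟨ cong (x ∧_) y≼z ⟩
    x ∧ y           ≡⟨ x≼y ⟩
    x               ∎
    where open ≡-Reasoning

  ≼-isPreorder : IsPreorder _≡_ _≼_
  ≼-isPreorder = record
    { isEquivalence = isEquivalence
    ; reflexive     = ≼-reflexive
    ; trans         = ≼-trans
    }

  module ≼-Reasoning where
    open import Relation.Binary.Reasoning.Base.Double ≼-isPreorder public

  open ≼-Reasoning

  ≼-𝟏 : ∀ x → x ≼ 𝟏
  ≼-𝟏 = 𝟏-greatest

  ⊗-identityˡ : ∀ x → 𝟏 ⊗ x ≡ x
  ⊗-identityˡ x rewrite ⊗-comm 𝟏 x = ⊗-identityʳ x

  ⊗-monoˡ : ∀ {x y} c → x ≼ y → x ⊗ c ≼ y ⊗ c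
  ⊗-monoˡ {x} {y} c x≼y =
    residuated₂ x c (y ⊗ c) (≼-trans x≼y (residuated₁ y c (y ⊗ c) (≼-refl _)))

  ⊗-monoʳ : ∀ {x y} c → x ≼ y → c ⊗ x ≼ c ⊗ y
  ⊗-monoʳ {x} {y} c x≼y = begin
    c ⊗ x   ≡⟨ ⊗-comm c x ⟩
    x ⊗ c   ≲⟨ ⊗-monoˡ c x≼y ⟩
    y ⊗ c   ≡⟨ ⊗-comm y c ⟩
    c ⊗ y   ∎

  ⊗-mono : ∀ {x y u v} → x ≼ y → u ≼ v → x ⊗ u ≼ y ⊗ v
  ⊗-mono {y = y} {u = u} x≼y u≼v = ≼-trans (⊗-monoˡ u x≼y) (⊗-monoʳ y u≼v)

  ⊗-decreasingˡ : ∀ x y → x ⊗ y ≼ x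
  ⊗-decreasingˡ x y = ≼-trans (⊗-monoʳ x (≼-𝟏 y)) (≼-reflexive (⊗-identityʳ x))

  ⊗-decreasingʳ : ∀ x y → x ⊗ y ≼ y
  ⊗-decreasingʳ x y = ≼-trans (⊗-monoˡ y (≼-𝟏 x)) (≼-reflexive (⊗-identityˡ y))

  ⊗-interchange : ∀ u v p q → (u ⊗ v) ⊗ (p ⊗ q) ≡ (u ⊗ p) ⊗ (v ⊗ q)
  ⊗-interchange u v p q = begin-equality
    (u ⊗ v) ⊗ (p ⊗ q)   ≡⟨ ⊗-assoc u v (p ⊗ q) ⟩
    u ⊗ (v ⊗ (p ⊗ q))   ≡⟨ cong (u ⊗_) (⊗-assoc v p q) ⟨
    u ⊗ ((v ⊗ p) ⊗ q)   ≡⟨ cong (λ w → u ⊗ (w ⊗ q)) (⊗-comm v p) ⟩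
    u ⊗ ((p ⊗ v) ⊗ q)   ≡⟨ cong (u ⊗_) (⊗-assoc p v q) ⟩
    u ⊗ (p ⊗ (v ⊗ q))   ≡⟨ ⊗-assoc u p (v ⊗ q) ⟨
    (u ⊗ p) ⊗ (v ⊗ q)   ∎

  modus-ponens : ∀ x y → (x ⇒ y) ⊗ x ≼ y
  modus-ponens x y = residuated₂ (x ⇒ y) x y (≼-refl _)

  𝟏≼⇒ : ∀ {x y} → x ≼ y → 𝟏 ≼ x ⇒ y
  𝟏≼⇒ {x} {y} x≼y = residuated₁ 𝟏 x y (≼-trans (≼-reflexive (⊗-identityˡ x)) x≼y)

  ⇒-trans : ∀ x y z → (x ⇒ y) ⊗ (y ⇒ z) ≼ x ⇒ z
  ⇒-trans x y z = residuated₁ _ x z (begin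
    ((x ⇒ y) ⊗ (y ⇒ z)) ⊗ x   ≡⟨ ⊗-assoc (x ⇒ y) (y ⇒ z) x ⟩
    (x ⇒ y) ⊗ ((y ⇒ z) ⊗ x)   ≡⟨ cong ((x ⇒ y) ⊗_) (⊗-comm (y ⇒ z) x) ⟩
    (x ⇒ y) ⊗ (x ⊗ (y ⇒ z))   ≡⟨ ⊗-assoc (x ⇒ y) x (y ⇒ z) ⟨
    ((x ⇒ y) ⊗ x) ⊗ (y ⇒ z)   ≡⟨ ⊗-comm ((x ⇒ y) ⊗ x) (y ⇒ z) ⟩
    (y ⇒ z) ⊗ ((x ⇒ y) ⊗ x)   ≲⟨ ⊗-monoʳ (y ⇒ z) (modus-ponens x y) ⟩
    (y ⇒ z) ⊗ y               ≲⟨ modus-ponens y z ⟩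
    z                         ∎)

  ⇒-⊗-compatible : ∀ c x y → x ⇒ y ≼ (c ⊗ x) ⇒ (c ⊗ y)
  ⇒-⊗-compatible c x y = residuated₁ _ _ _ (begin
    (x ⇒ y) ⊗ (c ⊗ x)   ≡⟨ ⊗-comm (x ⇒ y) (c ⊗ x) ⟩
    (c ⊗ x) ⊗ (x ⇒ y)   ≡⟨ ⊗-assoc c x (x ⇒ y) ⟩
    c ⊗ (x ⊗ (x ⇒ y))   ≡⟨ cong (c ⊗_) (⊗-comm x (x ⇒ y)) ⟩
    c ⊗ ((x ⇒ y) ⊗ x)   ≲⟨ ⊗-monoʳ c (modus-ponens x y) ⟩
    c ⊗ y               ∎)

  -- Self-distributivity of ⇒ up to squaring the premise: the filter rule
  -- holds outright once p ⇒ p ⊗ p is available.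
  ⇒-self-distrib : ∀ p y z → (p ⇒ (y ⇒ z)) ⊗ (p ⇒ y) ≼ (p ⊗ p) ⇒ z
  ⇒-self-distrib p y z = residuated₁ _ _ _ (begin
    ((p ⇒ (y ⇒ z)) ⊗ (p ⇒ y)) ⊗ (p ⊗ p)   ≡⟨ ⊗-interchange (p ⇒ (y ⇒ z)) (p ⇒ y) p p ⟩
    ((p ⇒ (y ⇒ z)) ⊗ p) ⊗ ((p ⇒ y) ⊗ p)   ≲⟨ ⊗-mono (modus-ponens p (y ⇒ z)) (modus-ponens p y) ⟩
    (y ⇒ z) ⊗ y                           ≲⟨ modus-ponens y z ⟩
    z                                     ∎)

  _^_ : Carrier → ℕ → Carrier
  _^_ = Defs._^_ L

  ^-≼-base : ∀ x m → x ^ suc m ≼ x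
  ^-≼-base x m = ⊗-decreasingˡ x (x ^ m)

module FilterProperties {a : Level} (L : ResiduatedLattice a)
    (F : ResiduatedLattice.Carrier L → Set a) (isFilter : IsFilter L F) where
  open ResiduatedLatticeProperties L
  open IsFilter isFilter

  𝟏∈F : F 𝟏
  𝟏∈F = up-closed (proj₂ nonempty) (≼-𝟏 _)

  ≼⇒∈F : ∀ {x y} → x ≼ y → F (x ⇒ y)
  ≼⇒∈F x≼y = up-closed 𝟏∈F (𝟏≼⇒ x≼y)

  ⇒∈F-trans : ∀ {x y z} → F (x ⇒ y) → F (y ⇒ z) → F (x ⇒ z)
  ⇒∈F-trans x⇒y y⇒z = up-closed (⊗-closed x⇒y y⇒z) (⇒-trans _ _ _)

  ⇒∈F-⊗-compatible : ∀ c {x y} → F (x ⇒ y) → F ((c ⊗ x) ⇒ (c ⊗ y))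
  ⇒∈F-⊗-compatible c x⇒y = up-closed x⇒y (⇒-⊗-compatible c _ _)

  ⇒∈F-iterate : ∀ x p → F (p ⇒ (x ⊗ p)) → ∀ k → F (p ⇒ ((x ^ k) ⊗ p))
  ⇒∈F-iterate x p p⇒xp zero = ≼⇒∈F (≼-reflexive (sym (⊗-identityˡ p)))
  ⇒∈F-iterate x p p⇒xp (suc k) =
    subst (λ w → F (p ⇒ w)) (sym (⊗-assoc x (x ^ k) p))
      (⇒∈F-trans p⇒xp (⇒∈F-⊗-compatible x (⇒∈F-iterate x p p⇒xp k)))

  nfold-filter⇒quotient : ∀ n → 1 ≤ n →
    IsNFoldImplicativeFilter L n F → QuotientIsNFoldImplicative L F n
  nfold-filter⇒quotient n@(suc m) (s≤s _) implicative x =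
    ≼⇒∈F (⊗-decreasingʳ x (x ^ n)) , x^n⇒x^[n+1]
    where
      open IsNFoldImplicativeFilter implicative
      x^n⇒x^[n+1] : F ((x ^ n) ⇒ (x ^ suc n))
      x^n⇒x^[n+1] = rule x x (x ^ suc n)
        (≼⇒∈F (residuated₁ _ _ _ (≼-reflexive (⊗-comm (x ^ n) x))))
        (≼⇒∈F (^-≼-base x m))

  quotient⇒nfold-filter : ∀ n →
    QuotientIsNFoldImplicative L F n → IsNFoldImplicativeFilter L n F
  quotient⇒nfold-filter n quotient = record
    { has-𝟏 = 𝟏∈F
    ; rule  = λ x y z x^n⇒[y⇒z] x^n⇒y →
        ⇒∈F-trans (x^n⇒x^n⊗x^n x)
          (up-closed (⊗-closed x^n⇒[y⇒z] x^n⇒y) (⇒-self-distrib (x ^ n) y z))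
    }
    where
      x^n⇒x^n⊗x^n : ∀ x → F ((x ^ n) ⇒ ((x ^ n) ⊗ (x ^ n)))
      x^n⇒x^n⊗x^n x = ⇒∈F-iterate x (x ^ n) (proj₂ (quotient x)) n

corollary4p15 : {a : Level} (L : ResiduatedLattice a) (n : ℕ) → 1 ≤ n →
    (F : ResiduatedLattice.Carrier L → Set a) → IsFilter L F →
    (IsNFoldImplicativeFilter L n F ⇔ QuotientIsNFoldImplicative L F n)
corollary4p15 L n n≥1 F isFilter =
  mk⇔ (nfold-filter⇒quotient n n≥1) (quotient⇒nfold-filter n)
  where open FilterProperties L F isFilter
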